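{- Let $r\ge 2$ be an integer. Then there exists $\sigma\in\mathcal{A}_r$ (so $\sigma\subseteq Q_{r+1}$ is a maximal simplex of $\mathrm{VR}(Q_{r+1};r)$) such that $\mathrm{localDiam}(\sigma,y)=r$ for all $y\in\sigma$ and $\mathrm{cHull}(\sigma)=Q_{r+1}$.
   Context: $Q_m$ denotes $\{0,1\}^m$ with the $\ell^1$ (Hamming) metric $d$. $\mathrm{VR}(X;r)$ is the simplicial complex on vertex set $X$ whose simplices are finite subsets of diameter at most $r$. For $a\in Q_m$, $\bar a=(1,\dots,1)-a$. $\mathcal{A}_r=\{Y\subseteq Q_{r+1}: \text{for all } x\in Q_{r+1},\ x\in Y\iff \bar x\notin Y\}$. For finite $A$ and $a\in A$, $\mathrm{localDiam}(A,a)=\max_{b\in A}d(a,b)$. A subcube of $Q_m$ is a set of the form $\{x\in Q_m : x_i=b_i \text{ for } i\notin S\}$ for some $S\subseteq[m]$ and $b\in\{0,1\}^{[m]\setminus S}$; the cubic hull $\mathrm{cHull}(B)$ of $B\subseteq Q_m$ is the smallest subcube containing $B$. -}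

module Defs where

open import Data.Bool using (Bool; true; false; not; if_then_else_; _xor_)
open import Data.Nat using (ℕ; zero; suc; _+_; _⊔_)
open import Data.Fin using (Fin)
open import Data.Vec using (Vec; []; _∷_; map; lookup)
open import Data.List using (List; []; _∷_; _++_; filter; foldr)
import Data.List as L
open import Relation.Binary.PropositionalEquality using (_≡_)
open import Data.Product using (_×_)

Q : ℕ → Set
Q m = Vec Bool m

d : ∀ {m} → Q m → Q m → ℕ
d [] [] = 0
d (x ∷ xs) (y ∷ ys) = (if x xor y then 1 else 0) + d xs ys

bar : ∀ {m} → Q m → Q m
bar = map not

SubsetQ : ℕ → Set
SubsetQ m = Q m → Bool

_∈S_ : ∀ {m} → Q m → SubsetQ m → Set
x ∈S Y = Y x ≡ true

allQ : (m : ℕ) → List (Q m)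
allQ zero = [] ∷ []
allQ (suc m) = L.map (false ∷_) (allQ m) ++ L.map (true ∷_) (allQ m)

InA : (r : ℕ) → SubsetQ (suc r) → Set
InA r Y = ∀ (x : Q (suc r)) → (Y x ≡ true → Y (bar x) ≡ false) × (Y (bar x) ≡ false → Y x ≡ true)

localDiam : ∀ {m} → SubsetQ m → Q m → ℕ
localDiam {m} A a = foldr (λ b acc → (if A b then d a b else 0) ⊔ acc) 0 (allQ m)

-- subcubes: S marks the free coordinates, b gives the values at fixed coordinates
-- (values of b at free coordinates are irrelevant)
record Subcube (m : ℕ) : Set where
  constructor subcube
  field
    free : Vec Bool m
    base : Vec Bool m

_∈C_ : ∀ {m} → Q m → Subcube m → Set
_∈C_ {m} x (subcube S b) = ∀ (i : Fin m) → lookup S i ≡ false → lookup x i ≡ lookup b i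

-- cHull(B) = Q_m : the smallest subcube containing B is all of Q_m,
-- i.e. every subcube containing B contains every point of Q_m
CHullIsFull : ∀ {m} → SubsetQ m → Set
CHullIsFull {m} B = ∀ (C : Subcube m) → (∀ x → x ∈S B → x ∈C C) → ∀ (x : Q m) → x ∈C C

{-# OPTIONS --safe #-}
module Submission where

-- Take σ to be the set of points whose first three coordinates have even parity.
-- The antipode flips that parity, so σ ∈ 𝒜_r. Two points of σ cannot be antipodal
-- on the first three coordinates, so they differ in at most two of them and
-- d ≤ 2 + (r − 2) = r; flipping two of the first three coordinates and all of the
-- remaining r − 2 stays in σ and realises distance r. Finally every coordinate
-- takes both values on σ, so no proper subcube contains σ.

open import Defs
open import Data.Nat using (ℕ; suc; _≤_)
open import Data.Product using (Σ; _×_)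
open import Relation.Binary.PropositionalEquality using (_≡_)

open import Data.Bool using (Bool; true; false; not; if_then_else_; _xor_)
open import Data.Bool.Properties using (not-¬)
open import Data.Empty using (⊥-elim)
open import Data.Fin using (Fin) renaming (zero to fzero; suc to fsuc)
open import Data.List using (List; []; _∷_; foldr)
open import Data.List.Membership.Propositional using (_∈_)
open import Data.List.Membership.Propositional.Properties using (∈-map⁺; ∈-++⁺ˡ; ∈-++⁺ʳ)
open import Data.List.Relation.Unary.Any using (here; there)
import Data.List as List
open import Data.Nat using (_+_; _⊔_; _<_; z≤n; s≤s)
open import Data.Nat.Properties
  using (≤-trans; ≤-antisym; ≤-reflexive; ≤-pred; n≤1+n; +-assoc; +-mono-≤; m≤m⊔n; m≤n⊔m; ⊔-lub; module ≤-Reasoning)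
open import Data.Product using (_,_; ∃₂)
open import Data.Vec using ([]; _∷_; _++_; lookup; replicate)
open import Data.Vec.Properties using (lookup-replicate)
open import Relation.Binary.PropositionalEquality using (_≢_; refl; sym; trans; cong; module ≡-Reasoning)

d-same-∷ : ∀ {m} x (xs ys : Q m) → d (x ∷ xs) (x ∷ ys) ≡ d xs ys
d-same-∷ false xs ys = refl
d-same-∷ true  xs ys = refl

d-not-∷ : ∀ {m} x (xs ys : Q m) → d (x ∷ xs) (not x ∷ ys) ≡ suc (d xs ys)
d-not-∷ false xs ys = refl
d-not-∷ true  xs ys = refl

d-++ : ∀ {m n} (xs ys : Q m) (xs′ ys′ : Q n) → d (xs ++ xs′) (ys ++ ys′) ≡ d xs ys + d xs′ ys′
d-++ []       []       xs′ ys′ = refl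
d-++ (x ∷ xs) (y ∷ ys) xs′ ys′ =
  trans (cong (_ +_) (d-++ xs ys xs′ ys′)) (sym (+-assoc (if x xor y then 1 else 0) _ _))

d≤dim : ∀ {m} (x y : Q m) → d x y ≤ m
d≤dim []           []           = z≤n
d≤dim (false ∷ xs) (false ∷ ys) = ≤-trans (d≤dim xs ys) (n≤1+n _)
d≤dim (false ∷ xs) (true  ∷ ys) = s≤s (d≤dim xs ys)
d≤dim (true  ∷ xs) (false ∷ ys) = s≤s (d≤dim xs ys)
d≤dim (true  ∷ xs) (true  ∷ ys) = ≤-trans (d≤dim xs ys) (n≤1+n _)

d-bar : ∀ {m} (x : Q m) → d x (bar x) ≡ m
d-bar []       = refl
d-bar (x ∷ xs) = trans (d-not-∷ x xs (bar xs)) (cong suc (d-bar xs))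

d<dim : ∀ {m} (x y : Q m) → y ≢ bar x → d x y < m
d<dim []           []           y≢x̄ = ⊥-elim (y≢x̄ refl)
d<dim (false ∷ xs) (false ∷ ys) _   = s≤s (d≤dim xs ys)
d<dim (true  ∷ xs) (true  ∷ ys) _   = s≤s (d≤dim xs ys)
d<dim (false ∷ xs) (true  ∷ ys) y≢x̄ = s≤s (d<dim xs ys (λ ys≡x̄s → y≢x̄ (cong (true ∷_) ys≡x̄s)))
d<dim (true  ∷ xs) (false ∷ ys) y≢x̄ = s≤s (d<dim xs ys (λ ys≡x̄s → y≢x̄ (cong (false ∷_) ys≡x̄s)))

∈-allQ : ∀ {m} (x : Q m) → x ∈ allQ m
∈-allQ []                     = here refl
∈-allQ {suc m} (false ∷ xs) = ∈-++⁺ˡ (∈-map⁺ (false ∷_) (∈-allQ xs))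
∈-allQ {suc m} (true  ∷ xs) = ∈-++⁺ʳ (List.map (false ∷_) (allQ m)) (∈-map⁺ (true ∷_) (∈-allQ xs))

module _ {m : ℕ} (A : SubsetQ m) (a : Q m) where

  private
    farthestIn : List (Q m) → ℕ
    farthestIn = foldr (λ b acc → (if A b then d a b else 0) ⊔ acc) 0

    farthestIn-≤ : ∀ {n} → (∀ b → b ∈S A → d a b ≤ n) → ∀ bs → farthestIn bs ≤ n
    farthestIn-≤ bound []       = z≤n
    farthestIn-≤ bound (b ∷ bs) with A b in b∈A
    ... | true  = ⊔-lub (bound b b∈A) (farthestIn-≤ bound bs)
    ... | false = ⊔-lub z≤n (farthestIn-≤ bound bs)

    d≤farthestIn : ∀ {b} bs → b ∈ bs → b ∈S A → d a b ≤ farthestIn bs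
    d≤farthestIn (b ∷ bs) (here refl) b∈A rewrite b∈A = m≤m⊔n _ _
    d≤farthestIn (_ ∷ bs) (there b∈bs) b∈A = ≤-trans (d≤farthestIn bs b∈bs b∈A) (m≤n⊔m _ _)

  localDiam-≡ : ∀ {n} → (∀ b → b ∈S A → d a b ≤ n) →
                ∀ b → b ∈S A → d a b ≡ n → localDiam A a ≡ n
  localDiam-≡ bound b b∈A dab≡n = ≤-antisym
    (farthestIn-≤ bound (allQ m))
    (≤-trans (≤-reflexive (sym dab≡n)) (d≤farthestIn (allQ m) (∈-allQ b) b∈A))

antipode-complement⇒InA : ∀ r (Y : SubsetQ (suc r)) → (∀ x → Y (bar x) ≡ not (Y x)) → InA r Y
antipode-complement⇒InA r Y Yx̄≡¬Yx x with Y x | Yx̄≡¬Yx x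
... | true  | Yx̄≡false = (λ _ → Yx̄≡false) , (λ _ → refl)
... | false | Yx̄≡true  = (λ ()) , (λ Yx̄≡false → ⊥-elim (not-¬ refl (trans (sym Yx̄≡true) Yx̄≡false)))

Separated : ∀ {m} → SubsetQ m → Fin m → Set
Separated B i = ∃₂ λ x y → x ∈S B × y ∈S B × lookup x i ≢ lookup y i

separated⇒CHullIsFull : ∀ {m} (B : SubsetQ m) → (∀ i → Separated B i) → CHullIsFull B
separated⇒CHullIsFull B separated (subcube S b) B⊆C z i i-fixed with separated i
... | x , y , x∈B , y∈B , xᵢ≢yᵢ = ⊥-elim (xᵢ≢yᵢ (trans (B⊆C x x∈B i i-fixed) (sym (B⊆C y y∈B i i-fixed))))

even3 : Q 3 → Bool
even3 (a ∷ b ∷ c ∷ []) = not (a xor (b xor c))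

even3-bar : ∀ v → even3 (bar v) ≡ not (even3 v)
even3-bar (false ∷ false ∷ false ∷ []) = refl
even3-bar (false ∷ false ∷ true  ∷ []) = refl
even3-bar (false ∷ true  ∷ false ∷ []) = refl
even3-bar (false ∷ true  ∷ true  ∷ []) = refl
even3-bar (true  ∷ false ∷ false ∷ []) = refl
even3-bar (true  ∷ false ∷ true  ∷ []) = refl
even3-bar (true  ∷ true  ∷ false ∷ []) = refl
even3-bar (true  ∷ true  ∷ true  ∷ []) = refl

even3-not-not : ∀ a b c → even3 (not a ∷ not b ∷ c ∷ []) ≡ even3 (a ∷ b ∷ c ∷ [])
even3-not-not false false false = refl
even3-not-not false false true  = refl
even3-not-not false true  false = refl
even3-not-not false true  true  = refl
even3-not-not true  false false = refl
even3-not-not true  false true  = refl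
even3-not-not true  true  false = refl
even3-not-not true  true  true  = refl

even3⇒≢bar : ∀ u v → even3 u ≡ true → even3 v ≡ true → v ≢ bar u
even3⇒≢bar u v eu ev refl = not-¬ refl (trans (sym ev) (trans (even3-bar u) (cong not eu)))

σ : ∀ {k} → SubsetQ (3 + k)
σ (a ∷ b ∷ c ∷ _) = even3 (a ∷ b ∷ c ∷ [])

σ-bar : ∀ {k} (x : Q (3 + k)) → σ (bar x) ≡ not (σ x)
σ-bar (a ∷ b ∷ c ∷ _) = even3-bar (a ∷ b ∷ c ∷ [])

σ-diam≤ : ∀ {k} (x y : Q (3 + k)) → x ∈S σ → y ∈S σ → d x y ≤ 2 + k
σ-diam≤ (a ∷ b ∷ c ∷ xs) (a′ ∷ b′ ∷ c′ ∷ ys) x∈σ y∈σ = begin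
  d (a ∷ b ∷ c ∷ xs) (a′ ∷ b′ ∷ c′ ∷ ys)  ≡⟨ d-++ u v xs ys ⟩
  d u v + d xs ys                         ≤⟨ +-mono-≤ (≤-pred (d<dim u v (even3⇒≢bar u v x∈σ y∈σ))) (d≤dim xs ys) ⟩
  2 + _                                   ∎
  where
  open ≤-Reasoning
  u v : Q 3
  u = a ∷ b ∷ c ∷ []
  v = a′ ∷ b′ ∷ c′ ∷ []

farPoint : ∀ {k} → Q (3 + k) → Q (3 + k)
farPoint (a ∷ b ∷ c ∷ xs) = not a ∷ not b ∷ c ∷ bar xs

farPoint-∈σ : ∀ {k} (x : Q (3 + k)) → x ∈S σ → farPoint x ∈S σ
farPoint-∈σ (a ∷ b ∷ c ∷ _) x∈σ = trans (even3-not-not a b c) x∈σ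

d-farPoint : ∀ {k} (x : Q (3 + k)) → d x (farPoint x) ≡ 2 + k
d-farPoint (a ∷ b ∷ c ∷ xs) = begin
  d (a ∷ b ∷ c ∷ xs) (not a ∷ not b ∷ c ∷ bar xs)  ≡⟨ d-not-∷ a (b ∷ c ∷ xs) _ ⟩
  suc (d (b ∷ c ∷ xs) (not b ∷ c ∷ bar xs))        ≡⟨ cong suc (d-not-∷ b (c ∷ xs) _) ⟩
  2 + d (c ∷ xs) (c ∷ bar xs)                      ≡⟨ cong (2 +_) (d-same-∷ c xs _) ⟩
  2 + d xs (bar xs)                                ≡⟨ cong (2 +_) (d-bar xs) ⟩
  2 + _                                            ∎
  where open ≡-Reasoning

σ-separated : ∀ {k} (i : Fin (3 + k)) → Separated (σ {k}) i
σ-separated {k} fzero                   = replicate _ false , (true  ∷ true ∷ false ∷ replicate k false) , refl , refl , (λ ())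
σ-separated {k} (fsuc fzero)            = replicate _ false , (true  ∷ true ∷ false ∷ replicate k false) , refl , refl , (λ ())
σ-separated {k} (fsuc (fsuc fzero))     = replicate _ false , (false ∷ true ∷ true  ∷ replicate k false) , refl , refl , (λ ())
σ-separated {k} (fsuc (fsuc (fsuc j)))  = replicate _ false , (false ∷ false ∷ false ∷ replicate k true) , refl , refl ,
  λ same → not-¬ refl (trans (sym (lookup-replicate j false)) (trans same (lookup-replicate j true)))

mainTheorem10 : (r : ℕ) → 2 ≤ r →
    Σ (SubsetQ (suc r)) (λ σ →
    InA r σ
    × (∀ (y : Q (suc r)) → y ∈S σ → localDiam σ y ≡ r)
    × CHullIsFull σ)
mainTheorem10 (suc (suc k)) (s≤s (s≤s z≤n)) =
    σ
  , antipode-complement⇒InA (2 + k) σ σ-bar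
  , (λ y y∈σ → localDiam-≡ σ y (λ b → σ-diam≤ y b y∈σ) (farPoint y) (farPoint-∈σ y y∈σ) (d-farPoint y))
  , separated⇒CHullIsFull σ σ-separated
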